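{- Let $\preceq$ be an ordering of $\mathbb{M}$, let $(\mathcal{T}=((V,E),\rho),\lambda)$ be a leaf-labeled tree, and let $\phi=\phi_{(\lambda,\preceq)}$ be the full labeling of $\mathcal{T}$ produced by Algorithm 1. Then for any two interior vertices $u,v\in V$, the leaf-labeled trees $(\mathcal{T}_u,\lambda_u)$ and $(\mathcal{T}_v,\lambda_v)$ are isomorphic if and only if $\phi(u)=\phi(v)$.
   Context: All graphs are finite. A rooted network $\mathcal{N}=(G,\rho)$ is a directed acyclic graph $G=(V,E)$ with a unique vertex $\rho$ of in-degree $0$ (the root). A leaf is a vertex of out-degree $0$; $L(\mathcal{N})$ denotes the set of leaves; non-leaf vertices are interior vertices. For a vertex $u$, $C_u=\{v:(u,v)\in E\}$ is the set of children of $u$. Let $\mathbb{N}^*=\{1,2,3,\dots\}$. A leaf labeling is any map $\lambda:L(\mathcal{N})\to\mathbb{N}^*$ (not necessarily injective), and $(\mathcal{N},\lambda)$ is a leaf-labeled network; it is a leaf-labeled tree if every vertex has in-degree at most $1$. Two leaf-labeled networks $(((V,E),\rho),\lambda)$ and $(((V',E'),\rho'),\lambda')$ are isomorphic if there is a digraph isomorphism $f:V\to V'$ with $\lambda(v)=\lambda'(f(v))$ for every leaf $v$. For a vertex $u$, $(\mathcal{N}_u,\lambda_u)$ is the leaf-labeled network whose rooted network has root $u$ and underlying graph the subgraph of $G$ induced by all vertices reachable from $u$ by a directed path (including $u$), and whose leaf labeling is the restriction of $\lambda$ to its leaves. $\mathbb{M}$ is the set of all finite non-empty multisets of elements of $\mathbb{N}^*$;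 $M(x)$ denotes the multiplicity of $x$ in $M$. An ordering $\preceq$ of $\mathbb{M}$ is a total order on $\mathbb{M}$. A full labeling of $\mathcal{N}$ is a map $\phi:V\to\mathbb{N}^*$; for an interior vertex $u$, $F_{(u,\phi)}$ is the multiset $\{\phi(v):v\in C_u\}$ (one entry per child). Algorithm 1 (input: an ordering $\preceq$ of $\mathbb{M}$ and a leaf-labeled network $(\mathcal{N},\lambda)$): set $\phi(v)=\lambda(v)$ for every leaf $v$; set $\mathbb{L}=\lambda(L(\mathcal{N}))$ and $U$ = set of interior vertices. While $U\neq\emptyset$: let $W$ be the set of $u\in U$ all of whose children already have a label; let $W'$ be the set of $w\in W$ such that $F_{(w,\phi)}$ is the minimum with respect to $\preceq$ of $\{F_{(w',\phi)}:w'\in W\}$; let $k=\min(\mathbb{N}^*\setminus\mathbb{L})$; set $\phi(w)=k$ for all $w\in W'$; add $k$ to $\mathbb{L}$; remove $W'$ from $U$. The resulting full labeling is denoted $\phi_{(\lambda,\preceq)}$. -}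

module Defs where

open import Data.Nat using (ℕ; zero; suc; _≤_; _<_)
open import Data.Fin using (Fin)
open import Data.Bool using (Bool; true; false)
open import Data.List using (List; []; _∷_; map; filterᵇ; allFin)
open import Data.List.Relation.Unary.All using (All)
open import Data.List.Relation.Binary.Permutation.Propositional using (_↭_)
open import Data.Product using (Σ; ∃; _×_; _,_)
open import Data.Sum using (_⊎_)
open import Data.Empty using (⊥)
open import Relation.Nullary using (¬_)
open import Relation.Binary.PropositionalEquality using (_≡_; _≢_)
open import Relation.Binary.Construct.Closure.ReflexiveTransitive using (Star)

Graph : ℕ → Set
Graph n = Fin n → Fin n → Bool

data Reach {n : ℕ} (E : Graph n) : Fin n → Fin n → Set where
  here : ∀ {u} → Reach E u u
  step : ∀ {u w v} → E u w ≡ true → Reach E w v → Reach E u v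

Acyclic : ∀ {n} → Graph n → Set
Acyclic {n} E = ∀ (u v : Fin n) → E u v ≡ true → ¬ Reach E v u

InDegreeZero : ∀ {n} → Graph n → Fin n → Set
InDegreeZero {n} E v = ∀ (u : Fin n) → E u v ≡ false

IsRootedNetwork : ∀ {n} → Graph n → Fin n → Set
IsRootedNetwork {n} E ρ =
  Acyclic E × InDegreeZero E ρ × (∀ (v : Fin n) → InDegreeZero E v → v ≡ ρ)

-- tree: every vertex has in-degree at most 1
InDegreeAtMostOne : ∀ {n} → Graph n → Set
InDegreeAtMostOne {n} E =
  ∀ (u u' v : Fin n) → E u v ≡ true → E u' v ≡ true → u ≡ u'

Leaf : ∀ {n} → Graph n → Fin n → Set
Leaf {n} E v = ∀ (w : Fin n) → E v w ≡ false

Interior : ∀ {n} → Graph n → Fin n → Set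
Interior E v = ¬ Leaf E v

-- a leaf labeling λ : L(N) → ℕ* is given as a map Fin n → ℕ whose
-- values on leaves are ≥ 1 (its values on interior vertices are ignored)
LeafLabeling : ∀ {n} → Graph n → (Fin n → ℕ) → Set
LeafLabeling {n} E lab = ∀ (v : Fin n) → Leaf E v → 1 ≤ lab v

children : ∀ {n} → Graph n → Fin n → List (Fin n)
children {n} E u = filterᵇ (E u) (allFin n)

-- Isomorphism of the leaf-labeled subnetworks (N_u, λ_u) and (N_v, λ_v).
-- N_u is the subgraph induced by the vertices reachable from u.

LeafIn : ∀ {n} → Graph n → Fin n → Fin n → Set
LeafIn {n} E u x = ∀ (y : Fin n) → Reach E u y → E x y ≡ false

record SubIso {n : ℕ} (E : Graph n) (lab : Fin n → ℕ) (u v : Fin n) : Set where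
  field
    f       : Fin n → Fin n
    g       : Fin n → Fin n
    f-into  : ∀ x → Reach E u x → Reach E v (f x)
    g-into  : ∀ y → Reach E v y → Reach E u (g y)
    g∘f     : ∀ x → Reach E u x → g (f x) ≡ x
    f∘g     : ∀ y → Reach E v y → f (g y) ≡ y
    f-edges : ∀ x x' → Reach E u x → Reach E u x' → E x x' ≡ E (f x) (f x')
    f-label : ∀ x → Reach E u x → LeafIn E u x → lab x ≡ lab (f x)

-- An element of 𝕄 is represented by a list (its entries, with
-- multiplicity); two lists represent the same multiset iff they are
-- permutations of each other (_↭_).  𝕄 = non-empty lists of elements of ℕ*.

InM : List ℕ → Set
InM []       = ⊥
InM (x ∷ xs) = All (1 ≤_) (x ∷ xs)

record IsOrderingM (_≼_ : List ℕ → List ℕ → Set) : Set where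
  field
    respects : ∀ xs xs' ys ys' → InM xs → InM ys →
               xs ↭ xs' → ys ↭ ys' → xs ≼ ys → xs' ≼ ys'
    refl′    : ∀ xs → InM xs → xs ≼ xs
    antisym  : ∀ xs ys → InM xs → InM ys → xs ≼ ys → ys ≼ xs → xs ↭ ys
    trans′   : ∀ xs ys zs → InM xs → InM ys → InM zs →
               xs ≼ ys → ys ≼ zs → xs ≼ zs
    total    : ∀ xs ys → InM xs → InM ys → (xs ≼ ys) ⊎ (ys ≼ xs)

-- Algorithm 1, as a relational specification of its runs.
-- A state is a map φ : Fin n → ℕ where φ v ≡ 0 means "v has no label yet"
-- (all genuine labels are in ℕ* = {1,2,...}).  In every state, U is the
-- set of unlabeled interior vertices and 𝕃 is the set of labels in use,
-- i.e. the positive values of φ.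

module Algorithm1 {n : ℕ} (E : Graph n) (_≼_ : List ℕ → List ℕ → Set)
                  (lab : Fin n → ℕ) where

  Init : (Fin n → ℕ) → Set
  Init φ = ∀ v → (Leaf E v → φ v ≡ lab v) × (Interior E v → φ v ≡ 0)

  InU : (Fin n → ℕ) → Fin n → Set
  InU φ u = Interior E u × φ u ≡ 0

  InW : (Fin n → ℕ) → Fin n → Set
  InW φ u = InU φ u × (∀ c → E u c ≡ true → φ c ≢ 0)

  F : (Fin n → ℕ) → Fin n → List ℕ
  F φ u = map φ (children E u)

  InW' : (Fin n → ℕ) → Fin n → Set
  InW' φ w = InW φ w × (∀ w' → InW φ w' → F φ w ≼ F φ w')

  MinFree : (Fin n → ℕ) → ℕ → Set
  MinFree φ k = 1 ≤ k × (∀ v → φ v ≢ k) × (∀ j → 1 ≤ j → j < k → ∃ λ v → φ v ≡ j)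

  Step : (Fin n → ℕ) → (Fin n → ℕ) → Set
  Step φ φ' = (∃ λ u → InU φ u) ×
              Σ ℕ λ k → MinFree φ k ×
                (∀ v → (InW' φ v → φ' v ≡ k) × (¬ InW' φ v → φ' v ≡ φ v))

  Final : (Fin n → ℕ) → Set
  Final φ = ∀ u → ¬ InU φ u

  Output : (Fin n → ℕ) → Set
  Output φ = Σ (Fin n → ℕ) λ φ₀ → Init φ₀ × Star Step φ₀ φ × Final φ

{-# OPTIONS --safe #-}
module Submission where

-- Follow the run of Algorithm 1 and show that every intermediate labeling φ (with φ v ≡ 0
-- meaning "not yet labeled") satisfies an invariant: labeled vertices have labeled children,
-- isomorphic vertices have equal labels, and vertices with equal nonzero labels are isomorphic. Membership in W′ is invariant under
-- isomorphism, because isomorphic vertices have the same multiset of child labels, so isomorphic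
-- vertices are relabeled together. Conversely, two vertices of W′ have ≼-minimal, hence (by
-- antisymmetry) equal, child multisets; pairing their children along that equality matches
-- children with equal labels, which are isomorphic by the invariant, and since distinct children
-- of a tree vertex have disjoint subtrees, these isomorphisms glue to one between the parents.
-- Defining the glued map requires deciding in which child's subtree a vertex lies, so the
-- invariant also records that the descendants of a labeled vertex are decidable.

open import Defs
open import Data.Bool using (Bool; true; false; T?)
open import Data.Bool.Properties using (not-¬; ¬-not; T-≡) renaming (_≟_ to _≟ᵇ_)
open import Data.Empty using (⊥-elim)
open import Data.Fin using (Fin)
open import Data.Fin.Properties using (any?) renaming (_≟_ to _≟ᶠ_)
open import Data.Nat using (ℕ; _≤_) renaming (_≟_ to _≟ⁿ_)
open import Data.Nat.Properties using (n≢0⇒n>0; ≤-decTotalOrder; ≤-totalOrder)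
open import Data.List using (List; []; _∷_; map; allFin)
open import Data.List.Properties using (map-cong-local; map-∘; ≡-dec)
open import Data.List.Sort ≤-decTotalOrder using (sort; sort-↭; sort-↗)
open import Data.List.Membership.Propositional using (_∈_)
open import Data.List.Membership.Propositional.Properties
  using (∈-filter⁺; ∈-filter⁻; ∈-allFin; ∈-map⁺; ∈-map⁻)
open import Data.List.Membership.Propositional.Properties.WithK using (unique∧set⇒bag)
open import Data.List.Relation.Unary.Any using (here; there)
open import Data.List.Relation.Unary.All using (All; []; _∷_; lookup; tabulate)
import Data.List.Relation.Unary.All.Properties as All
open import Data.List.Relation.Unary.AllPairs using ([]; _∷_)
open import Data.List.Relation.Unary.Unique.Propositional using (Unique)
open import Data.List.Relation.Unary.Unique.Propositional.Properties using (filter⁺; allFin⁺)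
open import Data.List.Relation.Unary.Sorted.TotalOrder.Properties using (↗↭↗⇒≋)
open import Data.List.Relation.Binary.BagAndSetEquality using (∼bag⇒↭)
open import Data.List.Relation.Binary.Pointwise
  using (Pointwise; []; _∷_; Pointwise-≡⇒≡; ≡⇒Pointwise-≡)
import Data.List.Relation.Binary.Pointwise as Pointwise
open import Data.List.Relation.Binary.Permutation.Propositional
  using (_↭_; ↭-refl; ↭-sym; ↭-trans; ↭⇒↭ₛ; module PermutationReasoning)
open import Data.List.Relation.Binary.Permutation.Propositional.Properties
  using (All-resp-↭; ∈-resp-↭; map⁺; ↭-map-inv)
import Data.List.Relation.Binary.Permutation.Setoid.Properties as Permutationₛ
open import Data.Product using (∃; ∃₂; _×_; _,_; proj₁; proj₂)
open import Data.Sum using (_⊎_; inj₁; inj₂)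
open import Function using (_∘_)
open import Function.Bundles using (Equivalence; _⇔_; mk⇔)
open import Relation.Nullary using (¬_; Dec; yes; no; Stable)
open import Relation.Nullary.Decidable using (decidable-stable)
import Relation.Nullary.Decidable as Dec
open import Relation.Unary using (Decidable)
open import Relation.Binary.Construct.Closure.ReflexiveTransitive using (Star; ε; _◅_)
open import Relation.Binary.PropositionalEquality
  using (_≡_; _≢_; refl; sym; trans; subst; subst₂; cong; cong₂; setoid; module ≡-Reasoning)

module Paths {n : ℕ} (E : Graph n) where

  edge⇒reach : ∀ {a b} → E a b ≡ true → Reach E a b
  edge⇒reach e = step e here

  reach-trans : ∀ {a b c} → Reach E a b → Reach E b c → Reach E a c
  reach-trans here       q = q
  reach-trans (step e p) q = step e (reach-trans p q)

  reach-last-edge : ∀ {a b} → Reach E a b → a ≡ b ⊎ ∃ λ p → Reach E a p × E p b ≡ true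
  reach-last-edge here = inj₁ refl
  reach-last-edge (step e r) with reach-last-edge r
  ... | inj₁ refl          = inj₂ (_ , here , e)
  ... | inj₂ (p , r′ , e′) = inj₂ (p , step e r′ , e′)

  reach-first-edge : ∀ {a b} → Reach E a b → a ≢ b → ∃ λ w → E a w ≡ true × Reach E w b
  reach-first-edge here       a≢b = ⊥-elim (a≢b refl)
  reach-first-edge (step e r) _   = _ , e , r

  edge⇒interior : ∀ {v c} → E v c ≡ true → Interior E v
  edge⇒interior {c = c} e l = not-¬ e (l c)

  leaf⊎edge : ∀ v → Leaf E v ⊎ ∃ λ c → E v c ≡ true
  leaf⊎edge v with any? (λ w → E v w ≟ᵇ true)
  ... | yes edge = inj₂ edge
  ... | no ∄edge = inj₁ (λ w → ¬-not (λ e → ∄edge (w , e)))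

  leaf? : Decidable (Leaf E)
  leaf? v with leaf⊎edge v
  ... | inj₁ l       = yes l
  ... | inj₂ (_ , e) = no (edge⇒interior e)

  interior⇒edge : ∀ {v} → Interior E v → ∃ λ c → E v c ≡ true
  interior⇒edge {v} iv with leaf⊎edge v
  ... | inj₁ l    = ⊥-elim (iv l)
  ... | inj₂ edge = edge

  leaf-reach⇒≡ : ∀ {c z} → Leaf E c → Reach E c z → z ≡ c
  leaf-reach⇒≡ l here       = refl
  leaf-reach⇒≡ l (step e _) = ⊥-elim (edge⇒interior e l)

  leaf-reach? : ∀ {c} → Leaf E c → Decidable (Reach E c)
  leaf-reach? {c} l z with z ≟ᶠ c
  ... | yes refl = yes here
  ... | no z≢c   = no (z≢c ∘ leaf-reach⇒≡ l)

  reach?-from-children : ∀ {v} → (∀ {c} → E v c ≡ true → Decidable (Reach E c)) →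
                         Decidable (Reach E v)
  reach?-from-children {v} child? z with z ≟ᶠ v
  ... | yes refl = yes here
  ... | no  z≢v  with any? through?
    where
      through? : ∀ c → Dec (E v c ≡ true × Reach E c z)
      through? c with E v c ≟ᵇ true
      ... | yes e = Dec.map′ (e ,_) proj₂ (child? e z)
      ... | no ¬e = no (¬e ∘ proj₁)
  ...   | yes (_ , e , r) = yes (step e r)
  ...   | no  ∄through    = no (∄through ∘ λ r → reach-first-edge r (z≢v ∘ sym))

  leafIn⇒leaf : ∀ {c x} → Reach E c x → LeafIn E c x → Leaf E x
  leafIn⇒leaf {x = x} r l w with E x w ≟ᵇ true
  ... | yes e = l w (reach-trans r (edge⇒reach e))
  ... | no ¬e = ¬-not ¬e

  ∈-children⁺ : ∀ {x c} → E x c ≡ true → c ∈ children E x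
  ∈-children⁺ {x} {c} e = ∈-filter⁺ (T? ∘ E x) (∈-allFin c) (Equivalence.from T-≡ e)

  ∈-children⁻ : ∀ {x c} → c ∈ children E x → E x c ≡ true
  ∈-children⁻ {x} m = Equivalence.to T-≡ (proj₂ (∈-filter⁻ (T? ∘ E x) {xs = allFin n} m))

  children-unique : ∀ x → Unique (children E x)
  children-unique x = filter⁺ (T? ∘ E x) (allFin⁺ n)

module DAG {n : ℕ} {E : Graph n} (acyclic : Acyclic E) where
  open Paths E

  no-loop : ∀ {a} → ¬ E a a ≡ true
  no-loop {a} e = acyclic a a e here

  reach-antisym : ∀ {a b} → Reach E a b → Reach E b a → a ≡ b
  reach-antisym here       _ = refl
  reach-antisym (step e r) q = ⊥-elim (acyclic _ _ e (reach-trans r q))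

module Tree {n : ℕ} {E : Graph n} (acyclic : Acyclic E) (tree : InDegreeAtMostOne E) where
  open Paths E

  reach-comparable : ∀ {a b w} → Reach E a w → Reach E b w → Reach E a b ⊎ Reach E b a
  reach-comparable here q = inj₂ q
  reach-comparable {a} (step {w = a′} e p) q with reach-comparable p q
  ... | inj₁ r = inj₁ (step e r)
  ... | inj₂ r with reach-last-edge r
  ...   | inj₁ refl = inj₁ (edge⇒reach e)
  ...   | inj₂ (p′ , r′ , e′) with tree p′ a a′ e′ e
  ...     | refl = inj₂ r′

  sibling-reach⇒≡ : ∀ {y d₁ d₂} → E y d₁ ≡ true → E y d₂ ≡ true → Reach E d₁ d₂ → d₁ ≡ d₂
  sibling-reach⇒≡ {y} {d₁} {d₂} e₁ e₂ r with reach-last-edge r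
  ... | inj₁ eq = eq
  ... | inj₂ (p , r′ , e) with tree p y d₂ e e₂
  ...   | refl = ⊥-elim (acyclic y d₁ e₁ r′)

  sibling-common-descendant⇒≡ : ∀ {y d₁ d₂ w} → E y d₁ ≡ true → E y d₂ ≡ true →
                                 Reach E d₁ w → Reach E d₂ w → d₁ ≡ d₂
  sibling-common-descendant⇒≡ e₁ e₂ r₁ r₂ with reach-comparable r₁ r₂
  ... | inj₁ r = sibling-reach⇒≡ e₁ e₂ r
  ... | inj₂ r = sym (sibling-reach⇒≡ e₂ e₁ r)

Unique-map⁺-on : ∀ {A B : Set} (f : A → B) {xs : List A} →
                 (∀ {a b} → a ∈ xs → b ∈ xs → f a ≡ f b → a ≡ b) →
                 Unique xs → Unique (map f xs)
Unique-map⁺-on f {[]}     _         []         = []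
Unique-map⁺-on f {x ∷ xs} injective (x∉ ∷ u) =
  All.map⁺ (tabulate λ {y} y∈ fx≡fy → lookup x∉ y∈ (injective (here refl) (there y∈) fx≡fy))
  ∷ Unique-map⁺-on f (λ a∈ b∈ → injective (there a∈) (there b∈)) u

true-iff⇒≡ : ∀ {p q : Bool} → (p ≡ true → q ≡ true) → (q ≡ true → p ≡ true) → p ≡ q
true-iff⇒≡ {false} {false} _ _ = refl
true-iff⇒≡ {false} {true}  _ k = k refl
true-iff⇒≡ {true}          h _ = sym (h refl)

_↭?_ : (xs ys : List ℕ) → Dec (xs ↭ ys)
xs ↭? ys with ≡-dec _≟ⁿ_ (sort xs) (sort ys)
... | yes eq = yes (begin
  xs      ↭⟨ sort-↭ xs ⟨
  sort xs ≡⟨ eq ⟩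
  sort ys ↭⟨ sort-↭ ys ⟩
  ys      ∎)
  where open PermutationReasoning
... | no neq = no λ p → neq (Pointwise-≡⇒≡ (↗↭↗⇒≋ ≤-totalOrder (sort-↗ xs) (sort-↗ ys)
                 (↭⇒↭ₛ (↭-trans (sort-↭ xs) (↭-trans p (↭-sym (sort-↭ ys)))))))

module Isomorphism {n : ℕ} {E : Graph n} (acyclic : Acyclic E) (lab : Fin n → ℕ) where
  open Paths E
  open DAG acyclic
  open SubIso

  infix 4 _≅_
  _≅_ : Fin n → Fin n → Set
  u ≅ v = SubIso E lab u v

  leaf⇒leafIn : ∀ {u x} → Leaf E x → LeafIn E u x
  leaf⇒leafIn l w _ = l w

  ≅-reach : ∀ {u v a b} (I : u ≅ v) → Reach E u a → Reach E a b → Reach E (f I a) (f I b)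
  ≅-reach I ra here = here
  ≅-reach {u} {a = a} I ra (step {w = w} e r) =
    step (trans (sym (f-edges I a w ra raw)) e) (≅-reach I raw r)
    where
      raw : Reach E u w
      raw = reach-trans ra (edge⇒reach e)

  ≅-label : ∀ {u v x} (I : u ≅ v) → Reach E u x → Leaf E x → lab x ≡ lab (f I x)
  ≅-label I rx l = f-label I _ rx (leaf⇒leafIn l)

  ≅-leafIn : ∀ {u v x} (I : u ≅ v) → Reach E u x → Leaf E (f I x) → LeafIn E u x
  ≅-leafIn I rx l w rw = trans (f-edges I _ w rx rw) (l (f I w))

  ≅-sym : ∀ {u v} → u ≅ v → v ≅ u
  ≅-sym I = record
    { f = g I ; g = f I ; f-into = g-into I ; g-into = f-into I
    ; g∘f = f∘g I ; f∘g = g∘f I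
    ; f-edges = λ a b ra rb → begin
        E a b                         ≡⟨ cong₂ E (f∘g I a ra) (f∘g I b rb) ⟨
        E (f I (g I a)) (f I (g I b)) ≡⟨ f-edges I _ _ (g-into I a ra) (g-into I b rb) ⟨
        E (g I a) (g I b)             ∎
    ; f-label = λ y ry ly → begin
        lab y             ≡⟨ cong lab (f∘g I y ry) ⟨
        lab (f I (g I y)) ≡⟨ f-label I _ (g-into I y ry) (≅-leafIn I (g-into I y ry)
                               (subst (Leaf E) (sym (f∘g I y ry)) (leafIn⇒leaf ry ly))) ⟨
        lab (g I y)       ∎
    }
    where open ≡-Reasoning

  ≅-root : ∀ {u v} (I : u ≅ v) → f I u ≡ v
  ≅-root {u} {v} I =
    reach-antisym (subst (Reach E (f I u)) (f∘g I v here) (≅-reach I here (g-into I v here)))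
                  (f-into I u here)

  ≅-edge : ∀ {u v c} (I : u ≅ v) → E u c ≡ true → E v (f I c) ≡ true
  ≅-edge {u} {c = c} I e =
    subst (λ z → E z (f I c) ≡ true) (≅-root I) (trans (sym (f-edges I u c here (edge⇒reach e))) e)

  ≅-interior : ∀ {u v} → u ≅ v → Interior E u → Interior E v
  ≅-interior I iu with interior⇒edge iu
  ... | _ , e = edge⇒interior (≅-edge I e)

  ≅-leaf : ∀ {u v} → u ≅ v → Leaf E u → Leaf E v
  ≅-leaf {v = v} I lu with leaf? v
  ... | yes lv = lv
  ... | no iv  = ⊥-elim (≅-interior (≅-sym I) iv lu)

  ≅-child : ∀ {u v c} (I : u ≅ v) → E u c ≡ true → c ≅ f I c
  ≅-child {u} {c = c} I e = record
    { f = f I ; g = g I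
    ; f-into = λ x r → ≅-reach I ruc r
    ; g-into = λ y r → subst (λ z → Reach E z (g I y)) (g∘f I c ruc)
                         (≅-reach (≅-sym I) (f-into I c ruc) r)
    ; g∘f = λ x r → g∘f I x (reach-trans ruc r)
    ; f∘g = λ y r → f∘g I y (reach-trans (f-into I c ruc) r)
    ; f-edges = λ x x′ r r′ → f-edges I x x′ (reach-trans ruc r) (reach-trans ruc r′)
    ; f-label = λ x r l → ≅-label I (reach-trans ruc r) (leafIn⇒leaf r l)
    }
    where
      ruc : Reach E u c
      ruc = edge⇒reach e

  leaves-≅ : ∀ {c d} → Leaf E c → Leaf E d → lab c ≡ lab d → c ≅ d
  leaves-≅ {c} {d} lc ld eq = record
    { f = λ _ → d ; g = λ _ → c ; f-into = λ _ _ → here ; g-into = λ _ _ → here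
    ; g∘f = λ _ r → sym (leaf-reach⇒≡ lc r) ; f∘g = λ _ r → sym (leaf-reach⇒≡ ld r)
    ; f-edges = λ x x′ r r′ → begin
        E x x′ ≡⟨ cong₂ E (leaf-reach⇒≡ lc r) (leaf-reach⇒≡ lc r′) ⟩
        E c c  ≡⟨ lc c ⟩
        false  ≡⟨ ld d ⟨
        E d d  ∎
    ; f-label = λ x r _ → trans (cong lab (leaf-reach⇒≡ lc r)) eq
    }
    where open ≡-Reasoning

  ≅-children-image : ∀ {x y} (J : x ≅ y) → children E y ↭ map (f J) (children E x)
  ≅-children-image {x} {y} J = ∼bag⇒↭ (unique∧set⇒bag (children-unique y)
    (Unique-map⁺-on (f J) injective (children-unique x)) (mk⇔ to from))
    where
      child-reach : ∀ {v a} → a ∈ children E v → Reach E v a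
      child-reach = edge⇒reach ∘ ∈-children⁻

      injective : ∀ {a b} → a ∈ children E x → b ∈ children E x → f J a ≡ f J b → a ≡ b
      injective {a} {b} a∈ b∈ fa≡fb =
        trans (sym (g∘f J a (child-reach a∈))) (trans (cong (g J) fa≡fb) (g∘f J b (child-reach b∈)))

      to : ∀ {z} → z ∈ children E y → z ∈ map (f J) (children E x)
      to {z} z∈ = subst (_∈ map (f J) (children E x)) (f∘g J z (child-reach z∈))
                    (∈-map⁺ (f J) (∈-children⁺ (≅-edge (≅-sym J) (∈-children⁻ z∈))))

      from : ∀ {z} → z ∈ map (f J) (children E x) → z ∈ children E y
      from z∈ with ∈-map⁻ (f J) z∈
      ... | c , c∈ , refl = ∈-children⁺ (≅-edge J (∈-children⁻ c∈))

  ≅-map-children : ∀ {A : Set} (h : Fin n → A) → (∀ {a b} → a ≅ b → h a ≡ h b) →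
                   ∀ {x y} → x ≅ y → map h (children E x) ↭ map h (children E y)
  ≅-map-children h h-inv {x} {y} J = begin
    map h (children E x)             ≡⟨ map-cong-local (tabulate (h-inv ∘ ≅-child J ∘ ∈-children⁻)) ⟩
    map (h ∘ f J) (children E x)     ≡⟨ map-∘ (children E x) ⟩
    map h (map (f J) (children E x)) ↭⟨ map⁺ h (≅-children-image J) ⟨
    map h (children E y)             ∎
    where open PermutationReasoning

module Gluing {n : ℕ} {E : Graph n} (acyclic : Acyclic E) (tree : InDegreeAtMostOne E)
              (lab : Fin n → ℕ) where
  open Paths E
  open DAG acyclic
  open Tree acyclic tree
  open Isomorphism acyclic lab
  open SubIso
  open ≡-Reasoning

  record Matched (c d : Fin n) : Set where
    constructor matched
    field
      iso     : c ≅ d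
      reachˡ? : Decidable (Reach E c)
      reachʳ? : Decidable (Reach E d)
  open Matched

  Matched-sym : ∀ {c d} → Matched c d → Matched d c
  Matched-sym (matched I c? d?) = matched (≅-sym I) d? c?

  Matching : List (Fin n) → List (Fin n) → Set
  Matching = Pointwise Matched

  Matching-sym : ∀ {cs ds} → Matching cs ds → Matching ds cs
  Matching-sym = Pointwise.symmetric Matched-sym

  data _∈ᵐ_ {c d} (M : Matched c d) : ∀ {cs ds} → Matching cs ds → Set where
    here  : ∀ {cs ds} {m : Matching cs ds} → M ∈ᵐ (M ∷ m)
    there : ∀ {c′ d′ cs ds} {M′ : Matched c′ d′} {m : Matching cs ds} → M ∈ᵐ m → M ∈ᵐ (M′ ∷ m)

  ∈ᵐ⇒∈ˡ : ∀ {c d cs ds} {M : Matched c d} {m : Matching cs ds} → M ∈ᵐ m → c ∈ cs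
  ∈ᵐ⇒∈ˡ here      = here refl
  ∈ᵐ⇒∈ˡ (there e) = there (∈ᵐ⇒∈ˡ e)

  ∈ᵐ⇒∈ʳ : ∀ {c d cs ds} {M : Matched c d} {m : Matching cs ds} → M ∈ᵐ m → d ∈ ds
  ∈ᵐ⇒∈ʳ here      = here refl
  ∈ᵐ⇒∈ʳ (there e) = there (∈ᵐ⇒∈ʳ e)

  ∈ᵐ-sym : ∀ {c d cs ds} {M : Matched c d} {m : Matching cs ds} →
           M ∈ᵐ m → Matched-sym M ∈ᵐ Matching-sym m
  ∈ᵐ-sym here      = here
  ∈ᵐ-sym (there e) = there (∈ᵐ-sym e)

  ∈ˡ⇒∈ᵐ : ∀ {c cs ds} (m : Matching cs ds) → c ∈ cs → ∃₂ λ d (M : Matched c d) → M ∈ᵐ m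
  ∈ˡ⇒∈ᵐ (M ∷ m) (here refl) = _ , M , here
  ∈ˡ⇒∈ᵐ (_ ∷ m) (there c∈) with ∈ˡ⇒∈ᵐ m c∈
  ... | d , M , e = d , M , there e

  glue : ∀ {cs ds} → Matching cs ds → Fin n → Fin n
  glue []                   z = z
  glue (matched I c? _ ∷ m) z with c? z
  ... | yes _ = f I z
  ... | no  _ = glue m z

  glued : ∀ {cs ds} → Fin n → Fin n → Matching cs ds → Fin n → Fin n
  glued x y m z with z ≟ᶠ x
  ... | yes _ = y
  ... | no  _ = glue m z

  glued-root : ∀ {cs ds} x y (m : Matching cs ds) → glued x y m x ≡ y
  glued-root x y m with x ≟ᶠ x
  ... | yes _   = refl
  ... | no  x≢x = ⊥-elim (x≢x refl)

  glued-below : ∀ {cs ds x z} y (m : Matching cs ds) → z ≢ x → glued x y m z ≡ glue m z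
  glued-below {x = x} {z} y m z≢x with z ≟ᶠ x
  ... | yes z≡x = ⊥-elim (z≢x z≡x)
  ... | no  _   = refl

  glue-sym-sym : ∀ {cs ds} (m : Matching cs ds) z →
                 glue (Matching-sym (Matching-sym m)) z ≡ glue m z
  glue-sym-sym []                   z = refl
  glue-sym-sym (matched I c? _ ∷ m) z with c? z
  ... | yes _ = refl
  ... | no  _ = glue-sym-sym m z

  glued-sym-sym : ∀ {cs ds} x y (m : Matching cs ds) z →
                  glued x y (Matching-sym (Matching-sym m)) z ≡ glued x y m z
  glued-sym-sym x y m z with z ≟ᶠ x
  ... | yes _ = refl
  ... | no  _ = glue-sym-sym m z

  glue-∈ᵐ : ∀ {x c d cs ds z} {M : Matched c d} {m : Matching cs ds} →
            All (λ c → E x c ≡ true) cs → Unique cs → M ∈ᵐ m → Reach E c z → glue m z ≡ f (iso M) z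
  glue-∈ᵐ {z = z} {m = matched I c? _ ∷ m} _ _ here r with c? z
  ... | yes _  = refl
  ... | no  ¬r = ⊥-elim (¬r r)
  glue-∈ᵐ {z = z} {m = matched I c? _ ∷ m} (e′ ∷ es) (c′∉ ∷ u) (there e) r with c? z
  ... | yes r′ = ⊥-elim (lookup c′∉ (∈ᵐ⇒∈ˡ e)
                   (sibling-common-descendant⇒≡ e′ (lookup es (∈ᵐ⇒∈ˡ e)) r′ r))
  ... | no  _  = glue-∈ᵐ es u e r

  module Children {x cs} (cs↭ : cs ↭ children E x) where

    edges : All (λ c → E x c ≡ true) cs
    edges = All-resp-↭ (↭-sym cs↭) (tabulate ∈-children⁻)

    unique : Unique cs
    unique = Permutationₛ.Unique-resp-↭ (setoid (Fin n)) (↭⇒↭ₛ (↭-sym cs↭)) (children-unique x)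

    complete : ∀ {c} → E x c ≡ true → c ∈ cs
    complete e = ∈-resp-↭ (↭-sym cs↭) (∈-children⁺ e)

  glued-∈ᵐ : ∀ {x y c d cs ds z} {M : Matched c d} {m : Matching cs ds} →
             cs ↭ children E x → M ∈ᵐ m → Reach E c z → glued x y m z ≡ f (iso M) z
  glued-∈ᵐ {x} {y} {z = z} {m = m} cs↭ e r = trans (glued-below y m z≢x) (glue-∈ᵐ edges unique e r)
    where
      open Children cs↭
      z≢x : z ≢ x
      z≢x refl = acyclic x _ (lookup edges (∈ᵐ⇒∈ˡ e)) r

  record Under {cs ds} (m : Matching cs ds) (z : Fin n) : Set where
    constructor under
    field
      {c d} : Fin n
      {M}   : Matched c d
      entry : M ∈ᵐ m
      reach : Reach E c z

  module Glued {x y cs ds} (cs↭ : cs ↭ children E x) (ds↭ : ds ↭ children E y)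
               (m : Matching cs ds) where
    private
      module X = Children cs↭
      module Y = Children ds↭

      m⁻ : Matching ds cs
      m⁻ = Matching-sym m

    root-or-under : ∀ {z} → Reach E x z → z ≡ x ⊎ Under m z
    root-or-under here       = inj₁ refl
    root-or-under (step e r) with ∈ˡ⇒∈ᵐ m (X.complete e)
    ... | _ , _ , entry = inj₂ (under entry r)

    glued-into : ∀ {z} → Reach E x z → Reach E y (glued x y m z)
    glued-into r with root-or-under r
    ... | inj₁ refl = subst (Reach E y) (sym (glued-root x y m)) here
    ... | inj₂ (under {M = M} e rc) =
      subst (Reach E y) (sym (glued-∈ᵐ cs↭ e rc))
            (step (lookup Y.edges (∈ᵐ⇒∈ʳ e)) (f-into (iso M) _ rc))

    glued-inverse : ∀ {z} → Reach E x z → glued y x m⁻ (glued x y m z) ≡ z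
    glued-inverse {z} r with root-or-under r
    ... | inj₁ refl = trans (cong (glued y x m⁻) (glued-root x y m)) (glued-root y x m⁻)
    ... | inj₂ (under {M = M} e rc) = begin
      glued y x m⁻ (glued x y m z) ≡⟨ cong (glued y x m⁻) (glued-∈ᵐ cs↭ e rc) ⟩
      glued y x m⁻ (f (iso M) z)   ≡⟨ glued-∈ᵐ ds↭ (∈ᵐ-sym e) (f-into (iso M) z rc) ⟩
      g (iso M) (f (iso M) z)      ≡⟨ g∘f (iso M) z rc ⟩
      z                            ∎

    glued-edge : ∀ {a b} → Reach E x a → Reach E x b → E a b ≡ true →
                 E (glued x y m a) (glued x y m b) ≡ true
    glued-edge ra rb e with root-or-under ra | root-or-under rb
    ... | inj₁ refl | inj₁ refl = ⊥-elim (no-loop e)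
    ... | inj₁ refl | inj₂ (under {M = M} eb rc)
      -- b is a child of x, hence the root of its own entry, which is sent to a child of y
      with sibling-reach⇒≡ (lookup X.edges (∈ᵐ⇒∈ˡ eb)) e rc
    ...   | refl = subst₂ (λ p q → E p q ≡ true) (sym (glued-root x y m))
                     (sym (trans (glued-∈ᵐ cs↭ eb rc) (≅-root (iso M))))
                     (lookup Y.edges (∈ᵐ⇒∈ʳ eb))
    glued-edge {b = b} ra rb e | inj₂ (under {c} {M = M} ea rc) | _ =
      subst₂ (λ p q → E p q ≡ true) (sym (glued-∈ᵐ cs↭ ea rc)) (sym (glued-∈ᵐ cs↭ ea rcb))
        (trans (sym (f-edges (iso M) _ _ rc rcb)) e)
      where
        rcb : Reach E c b
        rcb = reach-trans rc (edge⇒reach e)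

    glued-label : Interior E x → ∀ {z} → Reach E x z → LeafIn E x z → lab z ≡ lab (glued x y m z)
    glued-label ix r l with root-or-under r
    ... | inj₁ refl = ⊥-elim (ix (leafIn⇒leaf here l))
    ... | inj₂ (under {M = M} e rc) =
      trans (≅-label (iso M) rc (leafIn⇒leaf r l)) (cong lab (sym (glued-∈ᵐ cs↭ e rc)))

  glue-≅ : ∀ {x y cs ds} → Interior E x → cs ↭ children E x → ds ↭ children E y →
           Matching cs ds → x ≅ y
  glue-≅ {x} {y} ix cs↭ ds↭ m = record
    { f = glued x y m ; g = glued y x (Matching-sym m)
    ; f-into = λ _ → glued-into ; g-into = λ _ → Back.glued-into
    ; g∘f = λ _ → glued-inverse
    ; f∘g = λ w r → trans (sym (glued-sym-sym x y m (glued y x (Matching-sym m) w)))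
                          (Back.glued-inverse r)
    ; f-edges = λ a b ra rb → true-iff⇒≡ (glued-edge ra rb)
        (λ e → subst₂ (λ p q → E p q ≡ true) (glued-inverse ra) (glued-inverse rb)
                  (Back.glued-edge (glued-into ra) (glued-into rb) e))
    ; f-label = λ _ → glued-label ix
    }
    where
      open Glued cs↭ ds↭ m
      module Back = Glued ds↭ cs↭ (Matching-sym m)

module Run {n : ℕ} {E : Graph n} (acyclic : Acyclic E) (tree : InDegreeAtMostOne E)
           {_≼_ : List ℕ → List ℕ → Set} (ordering : IsOrderingM _≼_) (lab : Fin n → ℕ) where
  open Paths E
  open Isomorphism acyclic lab
  open Gluing acyclic tree lab
  open Algorithm1 E _≼_ lab
  open IsOrderingM ordering

  record Invariant (φ : Fin n → ℕ) : Set where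
    field
      children-labeled : ∀ {v c} → E v c ≡ true → φ v ≢ 0 → φ c ≢ 0
      labeled-reach?   : ∀ {v} → φ v ≢ 0 → Decidable (Reach E v)
      ≅⇒≡              : ∀ {x y} → x ≅ y → φ x ≡ φ y
      ≡⇒≅              : ∀ {x y} → φ x ≢ 0 → φ x ≡ φ y → x ≅ y

  init-invariant : ∀ {φ₀} → Init φ₀ → Invariant φ₀
  init-invariant {φ₀} init = record
    { children-labeled = λ e nz → ⊥-elim (nz (unlabeled (edge⇒interior e)))
    ; labeled-reach?   = λ nz → leaf-reach? (labeled⇒leaf nz)
    ; ≅⇒≡              = ≅⇒≡₀
    ; ≡⇒≅              = λ nz eq →
        let lx = labeled⇒leaf nz
            ly = labeled⇒leaf (nz ∘ trans eq)
        in leaves-≅ lx ly (trans (sym (leaf-label lx)) (trans eq (leaf-label ly)))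
    }
    where
      leaf-label : ∀ {v} → Leaf E v → φ₀ v ≡ lab v
      leaf-label {v} = proj₁ (init v)

      unlabeled : ∀ {v} → Interior E v → φ₀ v ≡ 0
      unlabeled {v} = proj₂ (init v)

      labeled⇒leaf : ∀ {v} → φ₀ v ≢ 0 → Leaf E v
      labeled⇒leaf {v} nz with leaf? v
      ... | yes l  = l
      ... | no  iv = ⊥-elim (nz (unlabeled iv))

      ≅⇒≡₀ : ∀ {x y} → x ≅ y → φ₀ x ≡ φ₀ y
      ≅⇒≡₀ {x} {y} J with leaf? x
      ... | yes lx = begin
        φ₀ x               ≡⟨ leaf-label lx ⟩
        lab x              ≡⟨ ≅-label J here lx ⟩
        lab (SubIso.f J x) ≡⟨ cong lab (≅-root J) ⟩
        lab y              ≡⟨ leaf-label (≅-leaf J lx) ⟨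
        φ₀ y               ∎
        where open ≡-Reasoning
      ... | no  ix = trans (unlabeled ix) (sym (unlabeled (≅-interior J ix)))

  InM-F : ∀ {φ w} → InW φ w → InM (F φ w)
  InM-F {φ} ((iw , _) , children≢0) with interior⇒edge iw
  ... | _ , e = nonEmpty (∈-map⁺ φ (∈-children⁺ e))
                  (All.map⁺ (tabulate (n≢0⇒n>0 ∘ children≢0 _ ∘ ∈-children⁻)))
    where
      nonEmpty : ∀ {z xs} → z ∈ xs → All (1 ≤_) xs → InM xs
      nonEmpty {xs = _ ∷ _} _ positive = positive

  InW-stable : ∀ {φ w} → Stable (InW φ w)
  InW-stable {φ} {w} ¬¬w =
    ( (λ l → ¬¬w (λ iw → proj₁ (proj₁ iw) l))
    , decidable-stable (φ w ≟ⁿ 0) (λ φw≢0 → ¬¬w (λ iw → φw≢0 (proj₂ (proj₁ iw)))) )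
    , λ c e φc≡0 → ¬¬w (λ iw → proj₂ iw c e φc≡0)

  module _ {φ} (inv : Invariant φ) where
    open Invariant inv

    InW-resp-≅ : ∀ {x y} → x ≅ y → InW φ x → InW φ y
    InW-resp-≅ J ((ix , φx≡0) , children≢0) =
      (≅-interior J ix , trans (sym (≅⇒≡ J)) φx≡0) ,
      λ d e φd≡0 → children≢0 _ (≅-edge (≅-sym J) e) (trans (sym (≅⇒≡ (≅-child (≅-sym J) e))) φd≡0)

    InW′-resp-≅ : ∀ {x y} → x ≅ y → InW' φ x → InW' φ y
    InW′-resp-≅ {x} {y} J (iwx , least) = InW-resp-≅ J iwx , λ w iw →
      respects (F φ x) (F φ y) (F φ w) (F φ w) (InM-F iwx) (InM-F iw)
               (≅-map-children φ ≅⇒≡ J) ↭-refl (least w iw)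

    F↭⇒≅ : ∀ {x y} → InW φ x → F φ x ↭ F φ y → x ≅ y
    F↭⇒≅ ((ix , _) , children≢0) p with ↭-map-inv φ p
    ... | cs , eq , children↭cs =
      glue-≅ ix (↭-sym children↭cs) ↭-refl
        (matching (All-resp-↭ children↭cs (tabulate (children≢0 _ ∘ ∈-children⁻)))
                  (Pointwise.map⁻ φ φ (≡⇒Pointwise-≡ (sym eq))))
      where
        matching : ∀ {cs ds} → All (λ c → φ c ≢ 0) cs →
                   Pointwise (λ c d → φ c ≡ φ d) cs ds → Matching cs ds
        matching []         []         = []
        matching (nz ∷ nzs) (eq ∷ eqs) =
          matched (≡⇒≅ nz eq) (labeled-reach? nz) (labeled-reach? (nz ∘ trans eq))
          ∷ matching nzs eqs

  record Relabeling (φ φ′ : Fin n → ℕ) : Set where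
    field
      k          : ℕ
      fresh      : ∀ v → φ v ≢ k
      relabeled  : ∀ {v} → InW' φ v → φ′ v ≡ k
      unchanged  : ∀ {v} → ¬ InW' φ v → φ′ v ≡ φ v

  step⇒relabeling : ∀ {φ φ′} → Step φ φ′ → Relabeling φ φ′
  step⇒relabeling (_ , k , (_ , fresh , _) , spec) = record
    { k = k ; fresh = fresh ; relabeled = proj₁ (spec _) ; unchanged = proj₂ (spec _) }

  module Relabel {φ φ′} (inv : Invariant φ) (R : Relabeling φ φ′) where
    open Invariant inv
    open Relabeling R

    -- W′ is not decidable (≼ is not), so a relabeled vertex is only known to lie in W′ up to
    -- double negation; every conclusion drawn from it below is stable.
    New Old : Fin n → Set
    New v = φ′ v ≡ k × ¬ ¬ InW' φ v
    Old v = φ′ v ≡ φ v × ¬ InW' φ v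

    new-or-old : ∀ v → New v ⊎ Old v
    new-or-old v with φ′ v ≟ⁿ k
    ... | yes eq = inj₁ (eq , λ ¬w → fresh v (trans (sym (unchanged ¬w)) eq))
    ... | no  ne = inj₂ (unchanged (ne ∘ relabeled) , ne ∘ relabeled)

    new⇒InW : ∀ {v} → New v → InW φ v
    new⇒InW (_ , ¬¬w) = InW-stable (λ ¬iw → ¬¬w (¬iw ∘ proj₁))

    old≢k : ∀ {v} → Old v → φ′ v ≢ k
    old≢k {v} (eq , _) = fresh v ∘ trans (sym eq)

    old-labeled : ∀ {v} → Old v → φ′ v ≢ 0 → φ v ≢ 0
    old-labeled (eq , _) nz = nz ∘ trans eq

    labeled-stays : ∀ {v} → φ v ≢ 0 → φ′ v ≢ 0
    labeled-stays nz = nz ∘ trans (sym (unchanged (λ w → nz (proj₂ (proj₁ (proj₁ w))))))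

    minima-F↭ : ∀ {x y} → New x → New y → F φ x ↭ F φ y
    minima-F↭ {x} {y} (_ , ¬¬wx) (_ , ¬¬wy) = decidable-stable (F φ x ↭? F φ y) λ ¬p →
      ¬¬wx λ (iwx , x-least) → ¬¬wy λ (iwy , y-least) →
        ¬p (antisym _ _ (InM-F iwx) (InM-F iwy) (x-least y iwy) (y-least x iwx))

    children-labeled′ : ∀ {v c} → E v c ≡ true → φ′ v ≢ 0 → φ′ c ≢ 0
    children-labeled′ {v} e nz with new-or-old v
    ... | inj₁ new = labeled-stays (proj₂ (new⇒InW new) _ e)
    ... | inj₂ old = labeled-stays (children-labeled e (old-labeled old nz))

    labeled-reach?′ : ∀ {v} → φ′ v ≢ 0 → Decidable (Reach E v)
    labeled-reach?′ {v} nz with new-or-old v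
    ... | inj₁ new = reach?-from-children (labeled-reach? ∘ proj₂ (new⇒InW new) _)
    ... | inj₂ old = labeled-reach? (old-labeled old nz)

    ≅⇒≡′ : ∀ {x y} → x ≅ y → φ′ x ≡ φ′ y
    ≅⇒≡′ {x} {y} J with new-or-old x | new-or-old y
    ... | inj₁ (ex , _)   | inj₁ (ey , _)   = trans ex (sym ey)
    ... | inj₁ (_ , ¬¬wx) | inj₂ (_ , ¬wy)  = ⊥-elim (¬¬wx (¬wy ∘ InW′-resp-≅ inv J))
    ... | inj₂ (_ , ¬wx)  | inj₁ (_ , ¬¬wy) = ⊥-elim (¬¬wy (¬wx ∘ InW′-resp-≅ inv (≅-sym J)))
    ... | inj₂ (ex , _)   | inj₂ (ey , _)   = trans ex (trans (≅⇒≡ J) (sym ey))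

    ≡⇒≅′ : ∀ {x y} → φ′ x ≢ 0 → φ′ x ≡ φ′ y → x ≅ y
    ≡⇒≅′ {x} {y} nz eq with new-or-old x | new-or-old y
    ... | inj₁ newx         | inj₁ newy     = F↭⇒≅ inv (new⇒InW newx) (minima-F↭ newx newy)
    ... | inj₁ (ex , _)     | inj₂ old      = ⊥-elim (old≢k old (trans (sym eq) ex))
    ... | inj₂ old          | inj₁ (ey , _) = ⊥-elim (old≢k old (trans eq ey))
    ... | inj₂ old@(ex , _) | inj₂ (ey , _) =
      ≡⇒≅ (old-labeled old nz) (trans (sym ex) (trans eq ey))

    invariant′ : Invariant φ′
    invariant′ = record
      { children-labeled = children-labeled′
      ; labeled-reach?   = labeled-reach?′
      ; ≅⇒≡              = ≅⇒≡′
      ; ≡⇒≅              = ≡⇒≅′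
      }

  run-invariant : ∀ {φ φ′} → Star Step φ φ′ → Invariant φ → Invariant φ′
  run-invariant ε        inv = inv
  run-invariant (s ◅ ss) inv = run-invariant ss (Relabel.invariant′ inv (step⇒relabeling s))

lemma2p1 : ∀ {n : ℕ} (E : Graph n) (ρ : Fin n) →
             IsRootedNetwork E ρ → InDegreeAtMostOne E →
             (_≼_ : List ℕ → List ℕ → Set) → IsOrderingM _≼_ →
             (lab : Fin n → ℕ) → LeafLabeling E lab →
             (φ : Fin n → ℕ) → Algorithm1.Output E _≼_ lab φ →
             ∀ (u v : Fin n) → Interior E u → Interior E v →
             (SubIso E lab u v ⇔ (φ u ≡ φ v))
lemma2p1 E ρ (acyclic , _) tree _≼_ ordering lab _ φ (φ₀ , init , run , final) u v iu _ =
  mk⇔ ≅⇒≡ (≡⇒≅ (λ φu≡0 → final u (iu , φu≡0)))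
  where
    open Run acyclic tree ordering lab
    open Invariant (run-invariant run (init-invariant init))
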